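{- For any path graph $P_r$ ($r\ge 1$) and any cycle graph $C_t$ ($t\ge 3$), $$\gamma_o(P_{r}\Box C_{t})\ge \gamma_o(P_r)\gamma_o(C_t).$$
   Context: All graphs are finite and simple; $P_r$ is the path on $r$ vertices and $C_t$ the cycle on $t$ vertices. For a graph with vertex set $V$, a vertex $v$ and $S\subseteq V$, let $\delta_S(v)=|N(v)\cap S|$ and $\overline{S}=V\setminus S$. A nonempty set $S\subseteq V$ is a global offensive alliance if $\delta_S(v)\ge \delta_{\overline{S}}(v)+1$ for every $v\in\overline{S}$; $\gamma_o(G)$ is the minimum cardinality of a global offensive alliance of $G$. $G\Box H$ is the Cartesian product: vertex set $V(G)\times V(H)$, with $(a,b)\sim(c,d)$ iff ($a=c$ and $b\sim d$ in $H$) or ($a\sim c$ in $G$ and $b=d$). -}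

module Defs where

open import Data.Nat using (ℕ; zero; suc; _+_; _*_; _≤_; _<_; _≥_; _≡ᵇ_)
open import Data.Bool using (Bool; true; false; _∧_; _∨_; not)
open import Data.Fin using (Fin; toℕ; remQuot)
open import Data.Fin.Subset using (Subset; _∈_; _∉_; ∣_∣; Nonempty)
open import Data.Vec using (lookup)
open import Data.List using (List; allFin; filterᵇ; length)
open import Data.Product using (Σ; _×_; _,_; proj₁; proj₂)
open import Relation.Binary.PropositionalEquality using (_≡_)

record Graph : Set where
  constructor mkGraph
  field
    n    : ℕ
    adj  : Fin n → Fin n → Bool
open Graph public

δ : (G : Graph) → Subset (n G) → Fin (n G) → ℕ
δ G S v = length (filterᵇ (λ u → adj G v u ∧ lookup S u) (allFin (n G)))

compl : ∀ {m} → Subset m → Subset m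
compl = Data.Vec.map not

IsGOA : (G : Graph) → Subset (n G) → Set
IsGOA G S = Nonempty S × (∀ v → v ∉ S → δ G S v ≥ δ G (compl S) v + 1)

IsGammaO : Graph → ℕ → Set
IsGammaO G k = (Σ (Subset (n G)) λ S → IsGOA G S × ∣ S ∣ ≡ k)
             × (∀ S → IsGOA G S → k ≤ ∣ S ∣)

P : ℕ → Graph
P r = mkGraph r (λ i j → (suc (toℕ i) ≡ᵇ toℕ j) ∨ (suc (toℕ j) ≡ᵇ toℕ i))

C : ℕ → Graph
C t = mkGraph t (λ i j → (suc (toℕ i) ≡ᵇ toℕ j) ∨ (suc (toℕ j) ≡ᵇ toℕ i)
                         ∨ ((toℕ i ≡ᵇ 0) ∧ (suc (toℕ j) ≡ᵇ t))
                         ∨ ((toℕ j ≡ᵇ 0) ∧ (suc (toℕ i) ≡ᵇ t)))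

-- Cartesian product G □ H on Fin (n G * n H) ≅ Fin (n G) × Fin (n H) via remQuot
_□_ : Graph → Graph → Graph
G □ H = mkGraph (n G * n H) λ x y →
  let a = proj₁ (remQuot {n G} (n H) x) ; b = proj₂ (remQuot {n G} (n H) x)
      c = proj₁ (remQuot {n G} (n H) y) ; d = proj₂ (remQuot {n G} (n H) y)
  in (eqF a c ∧ adj H b d) ∨ (adj G a c ∧ eqF b d)
  where
    eqF : ∀ {m} → Fin m → Fin m → Bool
    eqF i j = toℕ i ≡ᵇ toℕ j

-- A vertex outside a global offensive alliance S has more neighbours in S than outside it, so if
-- its degree is at most 2k it has fewer than k neighbours outside S.  The upper bounds on γ_o(P_r)
-- and γ_o(C_t) come from explicit alliances: all of P_1, the odd vertices of P_r (r ≥ 2), the even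
-- vertices of C_t, and all of C_t.  For the lower bound on γ_o(P_r □ C_t): when r = 1 the graph is
-- the cycle C_t of degree 2, so S covers every edge and |S| ≥ ⌈t/2⌉.  When r ≥ 2 all degrees are at
-- most 4, so every 4-cycle spanned by two adjacent rows and two adjacent columns contains two
-- vertices of S; going around the columns, two adjacent rows contain at least t vertices of S, and
-- pairing up the rows gives |S| ≥ ⌊r/2⌋ t.

module Submission where

open import Data.Bool using (Bool; true; false; _∧_; _∨_; not; T)
open import Data.Bool.Properties using (not-involutive; ∨-comm; T-∧; T-∨)
open import Data.Empty using (⊥; ⊥-elim)
open import Data.Fin using (Fin; zero; suc; toℕ; combine; remQuot; inject₁; fromℕ; _↑ˡ_; _↑ʳ_)
open import Data.Fin.Properties using (toℕ-fromℕ; toℕ<n; toℕ-injective; remQuot-combine)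
open import Data.Fin.Subset using (Subset; ⊤; ∣_∣; _∉_; Nonempty)
open import Data.Fin.Subset.Properties using (∈⊤; ∣⊤∣≡n)
open import Data.List using (filterᵇ; length; tabulate)
open import Data.Nat using (ℕ; zero; suc; pred; _+_; _*_; _≤_; _<_; _≥_; _≡ᵇ_; z≤n; s≤s; ⌊_/2⌋; ⌈_/2⌉)
open import Data.Nat.Properties
open import Data.Product using (_×_; _,_; proj₁; proj₂; ∃-syntax)
open import Data.Sum as Sum using (_⊎_; inj₁; inj₂; [_,_])
open import Data.Vec using ([]; _∷_; lookup; here; there)
open import Data.Vec.Properties using (lookup-map; []=⇒lookup; lookup⇒[]=)
open import Function using (_∘_; _$_)
open import Function.Bundles using (Equivalence)
open import Relation.Binary.PropositionalEquality
  using (_≡_; _≢_; refl; sym; trans; cong; cong₂; subst; subst₂; module ≡-Reasoning)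
open import Relation.Nullary using (yes; no; contradiction)

open import Algebra.Properties.CommutativeMonoid.Sum +-0-commutativeMonoid
  using (sum; sum-syntax; sum-cong-≗; ∑-distrib-+; sum-init-last; sum-replicate-zero)

open import Defs

open Equivalence using (to; from)

𝟙 : Bool → ℕ
𝟙 true  = 1
𝟙 false = 0

𝟙-mono : ∀ {x y} → (T x → T y) → 𝟙 x ≤ 𝟙 y
𝟙-mono {false}         _   = z≤n
𝟙-mono {true}  {true}  _   = ≤-refl
𝟙-mono {true}  {false} x⇒y = ⊥-elim (x⇒y _)

𝟙-T : ∀ {x} → T x → 𝟙 x ≡ 1
𝟙-T {true} _ = refl

𝟙-∨≤ : ∀ x y → 𝟙 (x ∨ y) ≤ 𝟙 x + 𝟙 y
𝟙-∨≤ true  y = s≤s z≤n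
𝟙-∨≤ false y = ≤-refl

𝟙-∧ : ∀ x y → 𝟙 (x ∧ y) ≡ 𝟙 x * 𝟙 y
𝟙-∧ true  y = sym (+-identityʳ (𝟙 y))
𝟙-∧ false y = refl

𝟙-one-of : ∀ x y → (x ≡ false → y ≡ false → ⊥) → 1 ≤ 𝟙 x + 𝟙 y
𝟙-one-of true  y     _       = s≤s z≤n
𝟙-one-of false true  _       = s≤s z≤n
𝟙-one-of false false neither = ⊥-elim (neither refl refl)

𝟙-∧-split : ∀ x y → 𝟙 (x ∧ y) + 𝟙 (x ∧ not y) ≡ 𝟙 x
𝟙-∧-split true  true  = refl
𝟙-∧-split true  false = refl
𝟙-∧-split false y     = refl

-- groups the disjuncts of the adjacency of C into a successor and a predecessor part
𝟙-∨₄≤ : ∀ a b c d → 𝟙 (a ∨ b ∨ c ∨ d) ≤ 𝟙 (a ∨ d) + 𝟙 (b ∨ c)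
𝟙-∨₄≤ true  b     c     d = s≤s z≤n
𝟙-∨₄≤ false true  c     d = m≤n+m 1 (𝟙 d)
𝟙-∨₄≤ false false true  d = m≤n+m 1 (𝟙 d)
𝟙-∨₄≤ false false false d = m≤m+n (𝟙 d) 0

≡ᵇ-refl : ∀ m → T (m ≡ᵇ m)
≡ᵇ-refl m = ≡⇒≡ᵇ m m refl

sum-mono-≤ : ∀ {n} {f g : Fin n → ℕ} → (∀ i → f i ≤ g i) → sum f ≤ sum g
sum-mono-≤ {zero}  _   = z≤n
sum-mono-≤ {suc n} f≤g = +-mono-≤ (f≤g zero) (sum-mono-≤ (f≤g ∘ suc))

sum-const : ∀ n k → ∑[ i < n ] k ≡ n * k
sum-const zero    k = refl
sum-const (suc n) k = cong (k +_) (sum-const n k)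

sum-*ˡ : ∀ {n} k (f : Fin n → ℕ) → ∑[ i < n ] (k * f i) ≡ k * sum f
sum-*ˡ {zero}  k f = sym (*-zeroʳ k)
sum-*ˡ {suc n} k f = trans (cong (k * f zero +_) (sum-*ˡ k (f ∘ suc))) (sym (*-distribˡ-+ k _ _))

sum-*+* : ∀ n k (f : Fin n → ℕ) l (g : Fin n → ℕ) → ∑[ i < n ] (k * f i + l * g i) ≡ k * sum f + l * sum g
sum-*+* n k f l g = trans (∑-distrib-+ (λ i → k * f i) (λ i → l * g i)) (cong₂ _+_ (sum-*ˡ k f) (sum-*ˡ l g))

sum-↑ : ∀ m {n} (f : Fin (m + n) → ℕ) → sum f ≡ ∑[ i < m ] f (i ↑ˡ n) + ∑[ j < n ] f (m ↑ʳ j)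
sum-↑ zero    f = refl
sum-↑ (suc m) f = trans (cong (f zero +_) (sum-↑ m (f ∘ suc))) (sym (+-assoc (f zero) _ _))

sum-combine : ∀ m {n} (f : Fin (m * n) → ℕ) → sum f ≡ ∑[ i < m ] ∑[ j < n ] f (combine i j)
sum-combine zero        f = refl
sum-combine (suc m) {n} f = trans (sum-↑ n f) (cong (sum (f ∘ (_↑ˡ m * n)) +_) (sum-combine m (f ∘ (n ↑ʳ_))))

f≤sum : ∀ {n} (f : Fin n → ℕ) i → f i ≤ sum f
f≤sum f zero    = m≤m+n (f zero) _
f≤sum f (suc i) = ≤-trans (f≤sum (f ∘ suc) i) (m≤n+m _ (f zero))

f+f≤sum : ∀ {n} (f : Fin n → ℕ) {i j} → i ≢ j → f i + f j ≤ sum f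
f+f≤sum f {zero}  {zero}  i≢j = contradiction refl i≢j
f+f≤sum f {zero}  {suc j} _   = +-monoʳ-≤ (f zero) (f≤sum (f ∘ suc) j)
f+f≤sum f {suc i} {zero}  _   = ≤-trans (≤-reflexive (+-comm (f (suc i)) _)) (+-monoʳ-≤ (f zero) (f≤sum (f ∘ suc) i))
f+f≤sum f {suc i} {suc j} i≢j = ≤-trans (f+f≤sum (f ∘ suc) (i≢j ∘ cong suc)) (m≤n+m _ (f zero))

∑𝟙[≡ᵇ]≤1 : ∀ n k → ∑[ j < n ] 𝟙 (k ≡ᵇ toℕ j) ≤ 1
∑𝟙[≡ᵇ]≤1 zero    k       = z≤n
∑𝟙[≡ᵇ]≤1 (suc n) zero    = ≤-reflexive (cong suc (sum-replicate-zero n))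
∑𝟙[≡ᵇ]≤1 (suc n) (suc k) = ∑𝟙[≡ᵇ]≤1 n k

∑𝟙≤1 : ∀ {n} (p : Fin n → Bool) k → (∀ j → T (p j) → toℕ j ≡ k) → ∑[ j < n ] 𝟙 (p j) ≤ 1
∑𝟙≤1 {n} p k only-k =
  ≤-trans (sum-mono-≤ λ j → 𝟙-mono (≡⇒≡ᵇ k (toℕ j) ∘ sym ∘ only-k j)) (∑𝟙[≡ᵇ]≤1 n k)

predᶜ : ∀ {n} → Fin (suc n) → Fin (suc n)
predᶜ zero    = fromℕ _
predᶜ (suc i) = inject₁ i

sum-predᶜ : ∀ {n} (f : Fin (suc n) → ℕ) → sum (f ∘ predᶜ) ≡ sum f
sum-predᶜ f = trans (+-comm (f (fromℕ _)) _) (sym (sum-init-last f))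

cycle-edge-bound : ∀ {n} k (f : Fin (suc n) → ℕ) → (∀ j → k ≤ f (predᶜ j) + f j) → suc n * k ≤ sum f + sum f
cycle-edge-bound {n} k f k≤ = begin
  suc n * k                          ≡⟨ sum-const (suc n) k ⟨
  ∑[ j < suc n ] k                   ≤⟨ sum-mono-≤ k≤ ⟩
  ∑[ j < suc n ] (f (predᶜ j) + f j) ≡⟨ ∑-distrib-+ (f ∘ predᶜ) f ⟩
  sum (f ∘ predᶜ) + sum f            ≡⟨ cong (_+ sum f) (sum-predᶜ f) ⟩
  sum f + sum f                      ∎
  where open ≤-Reasoning

path-matching-bound : ∀ {m} t (R : Fin m → ℕ) → (∀ i j → T (adj (P m) i j) → t ≤ R i + R j) → ⌊ m /2⌋ * t ≤ sum R
path-matching-bound {zero}        t R _     = z≤n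
path-matching-bound {suc zero}    t R _     = z≤n
path-matching-bound {suc (suc m)} t R pair≤ =
  ≤-trans (+-mono-≤ (pair≤ zero (suc zero) _)
                    (path-matching-bound t (λ i → R (suc (suc i))) λ i j → pair≤ (suc (suc i)) (suc (suc j))))
          (≤-reflexive (+-assoc (R zero) (R (suc zero)) _))

deg : (G : Graph) → Fin (n G) → ℕ
deg G v = ∑[ u < n G ] 𝟙 (adj G v u)

length-filterᵇ-tabulate : ∀ {A : Set} {n} (p : A → Bool) (f : Fin n → A) →
  length (filterᵇ p (tabulate f)) ≡ ∑[ i < n ] 𝟙 (p (f i))
length-filterᵇ-tabulate {n = zero}  p f = refl
length-filterᵇ-tabulate {n = suc n} p f with p (f zero)
... | true  = cong suc (length-filterᵇ-tabulate p (f ∘ suc))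
... | false = length-filterᵇ-tabulate p (f ∘ suc)

δ≡∑ : ∀ G S v → δ G S v ≡ ∑[ u < n G ] 𝟙 (adj G v u ∧ lookup S u)
δ≡∑ G S v = length-filterᵇ-tabulate (λ u → adj G v u ∧ lookup S u) (λ u → u)

δ+δ̄≡deg : ∀ G S v → δ G S v + δ G (compl S) v ≡ deg G v
δ+δ̄≡deg G S v = begin
  δ G S v + δ G (compl S) v          ≡⟨ cong₂ _+_ (δ≡∑ G S v) (δ≡∑ G (compl S) v) ⟩
  sum in-S + sum in-S̄                ≡⟨ ∑-distrib-+ in-S in-S̄ ⟨
  ∑[ u < n G ] (in-S u + in-S̄ u)     ≡⟨ sum-cong-≗ split ⟩
  deg G v                            ∎
  where
  open ≡-Reasoning
  in-S in-S̄ : Fin (n G) → ℕ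
  in-S  u = 𝟙 (adj G v u ∧ lookup S u)
  in-S̄ u = 𝟙 (adj G v u ∧ lookup (compl S) u)
  split : ∀ u → in-S u + in-S̄ u ≡ 𝟙 (adj G v u)
  split u rewrite lookup-map u not S = 𝟙-∧-split (adj G v u) (lookup S u)

∉⇒lookup≡false : ∀ {m} {S : Subset m} {v} → v ∉ S → lookup S v ≡ false
∉⇒lookup≡false {S = S} {v} v∉S with lookup S v in e
... | true  = contradiction (lookup⇒[]= v S e) v∉S
... | false = refl

lookup≡false⇒∉ : ∀ {m} {S : Subset m} {v} → lookup S v ≡ false → v ∉ S
lookup≡false⇒∉ e v∈S with () ← trans (sym ([]=⇒lookup v∈S)) e

goa-δ̄+δ̄<deg : ∀ {G S v} → IsGOA G S → v ∉ S → δ G (compl S) v + δ G (compl S) v < deg G v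
goa-δ̄+δ̄<deg {G} {S} {v} (_ , attacked) v∉S = begin-strict
  δ̄ + δ̄         <⟨ +-monoʳ-< δ̄ (subst (_≤ δ G S v) (+-comm δ̄ 1) (attacked v v∉S)) ⟩
  δ̄ + δ G S v   ≡⟨ +-comm δ̄ _ ⟩
  δ G S v + δ̄   ≡⟨ δ+δ̄≡deg G S v ⟩
  deg G v       ∎
  where
  open ≤-Reasoning
  δ̄ = δ G (compl S) v

outside-neighbour-counts : ∀ G S {v u} → T (adj G v u) → lookup S u ≡ false → 𝟙 (adj G v u ∧ lookup (compl S) u) ≡ 1
outside-neighbour-counts G S {u = u} vu u∉S =
  𝟙-T (from T-∧ (vu , subst T (sym (trans (lookup-map u not S) (cong not u∉S))) _))

goa-outside-edge : ∀ G {S v u} → IsGOA G S → deg G v ≤ 2 →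
  lookup S v ≡ false → T (adj G v u) → lookup S u ≡ false → ⊥
goa-outside-edge G {S} {v} {u} goa deg≤2 v∉S vu u∉S = <-irrefl refl (begin-strict
  2                                   ≤⟨ +-mono-≤ 1≤δ̄ 1≤δ̄ ⟩
  δ G (compl S) v + δ G (compl S) v   <⟨ goa-δ̄+δ̄<deg goa (lookup≡false⇒∉ v∉S) ⟩
  deg G v                             ≤⟨ deg≤2 ⟩
  2                                   ∎)
  where
  open ≤-Reasoning
  1≤δ̄ : 1 ≤ δ G (compl S) v
  1≤δ̄ = subst₂ _≤_ (outside-neighbour-counts G S vu u∉S) (sym (δ≡∑ G (compl S) v)) (f≤sum _ u)

goa-outside-cherry : ∀ {G S v x y} → IsGOA G S → deg G v ≤ 4 → lookup S v ≡ false →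
  T (adj G v x) → lookup S x ≡ false → T (adj G v y) → lookup S y ≡ false → x ≢ y → ⊥
goa-outside-cherry {G} {S} {v} goa deg≤4 v∉S vx x∉S vy y∉S x≢y = <-irrefl refl (begin-strict
  4                                   ≤⟨ +-mono-≤ 2≤δ̄ 2≤δ̄ ⟩
  δ G (compl S) v + δ G (compl S) v   <⟨ goa-δ̄+δ̄<deg goa (lookup≡false⇒∉ v∉S) ⟩
  deg G v                             ≤⟨ deg≤4 ⟩
  4                                   ∎)
  where
  open ≤-Reasoning
  2≤δ̄ : 2 ≤ δ G (compl S) v
  2≤δ̄ = subst₂ _≤_ (cong₂ _+_ (outside-neighbour-counts G S vx x∉S) (outside-neighbour-counts G S vy y∉S))
                   (sym (δ≡∑ G (compl S) v)) (f+f≤sum _ x≢y)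

□-adj : ∀ G H (a c : Fin (n G)) (b d : Fin (n H)) →
  adj (G □ H) (combine a b) (combine c d) ≡ ((toℕ a ≡ᵇ toℕ c) ∧ adj H b d) ∨ (adj G a c ∧ (toℕ b ≡ᵇ toℕ d))
□-adj G H a c b d =
  cong₂ (λ (a , b) (c , d) → ((toℕ a ≡ᵇ toℕ c) ∧ adj H b d) ∨ (adj G a c ∧ (toℕ b ≡ᵇ toℕ d)))
        (remQuot-combine a b) (remQuot-combine c d)

□-adj-row : ∀ G H {a c} b → T (adj G a c) → T (adj (G □ H) (combine a b) (combine c b))
□-adj-row G H {a} {c} b ac =
  subst T (sym (□-adj G H a c b b)) (from T-∨ (inj₂ (from T-∧ (ac , ≡ᵇ-refl (toℕ b)))))

□-adj-col : ∀ G H a {b d} → T (adj H b d) → T (adj (G □ H) (combine a b) (combine a d))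
□-adj-col G H a {b} {d} bd =
  subst T (sym (□-adj G H a a b d)) (from T-∨ (inj₁ (from T-∧ (≡ᵇ-refl (toℕ a) , bd))))

combine-≢ˡ : ∀ {m n} {a c : Fin m} (b d : Fin n) → a ≢ c → combine a b ≢ combine c d
combine-≢ˡ {a = a} {c} b d a≢c eq =
  a≢c (cong proj₁ (trans (sym (remQuot-combine a b)) (trans (cong (remQuot _) eq) (remQuot-combine c d))))

□-adj-𝟙≤ : ∀ G H a b c d → 𝟙 (adj (G □ H) (combine a b) (combine c d)) ≤
  𝟙 (toℕ a ≡ᵇ toℕ c) * 𝟙 (adj H b d) + 𝟙 (adj G a c) * 𝟙 (toℕ b ≡ᵇ toℕ d)
□-adj-𝟙≤ G H a b c d rewrite □-adj G H a c b d
  | sym (𝟙-∧ (toℕ a ≡ᵇ toℕ c) (adj H b d)) | sym (𝟙-∧ (adj G a c) (toℕ b ≡ᵇ toℕ d)) =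
  𝟙-∨≤ ((toℕ a ≡ᵇ toℕ c) ∧ adj H b d) (adj G a c ∧ (toℕ b ≡ᵇ toℕ d))

□-deg≤ : ∀ G H a b → deg (G □ H) (combine a b) ≤ deg G a + deg H b
□-deg≤ G H a b = begin
  deg (G □ H) (combine a b)
    ≡⟨ sum-combine (n G) _ ⟩
  ∑[ c < n G ] ∑[ d < n H ] 𝟙 (adj (G □ H) (combine a b) (combine c d))
    ≤⟨ sum-mono-≤ (λ c → sum-mono-≤ (□-adj-𝟙≤ G H a b c)) ⟩
  ∑[ c < n G ] ∑[ d < n H ] (𝟙 (a ≡ᶠ c) * 𝟙 (adj H b d) + 𝟙 (adj G a c) * 𝟙 (b ≡ᶠ d))
    ≡⟨ sum-cong-≗ (λ c → sum-*+* (n H) (𝟙 (a ≡ᶠ c)) (𝟙 ∘ adj H b) (𝟙 (adj G a c)) (𝟙 ∘ (b ≡ᶠ_))) ⟩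
  ∑[ c < n G ] (𝟙 (a ≡ᶠ c) * deg H b + 𝟙 (adj G a c) * ∑[ d < n H ] 𝟙 (b ≡ᶠ d))
    ≤⟨ sum-mono-≤ (λ c → +-monoʳ-≤ _ (*-monoʳ-≤ (𝟙 (adj G a c)) (∑𝟙[≡ᵇ]≤1 (n H) (toℕ b)))) ⟩
  ∑[ c < n G ] (𝟙 (a ≡ᶠ c) * deg H b + 𝟙 (adj G a c) * 1)
    ≡⟨ sum-cong-≗ (λ c → cong₂ _+_ (*-comm (𝟙 (a ≡ᶠ c)) (deg H b)) (*-comm (𝟙 (adj G a c)) 1)) ⟩
  ∑[ c < n G ] (deg H b * 𝟙 (a ≡ᶠ c) + 1 * 𝟙 (adj G a c))
    ≡⟨ sum-*+* (n G) (deg H b) (𝟙 ∘ (a ≡ᶠ_)) 1 (𝟙 ∘ adj G a) ⟩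
  deg H b * ∑[ c < n G ] 𝟙 (a ≡ᶠ c) + 1 * deg G a
    ≤⟨ +-mono-≤ (*-monoʳ-≤ (deg H b) (∑𝟙[≡ᵇ]≤1 (n G) (toℕ a))) (≤-reflexive (*-identityˡ (deg G a))) ⟩
  deg H b * 1 + deg G a
    ≡⟨ trans (cong (_+ deg G a) (*-identityʳ (deg H b))) (+-comm (deg H b) _) ⟩
  deg G a + deg H b ∎
  where
  open ≤-Reasoning
  _≡ᶠ_ : ∀ {m} → Fin m → Fin m → Bool
  i ≡ᶠ j = toℕ i ≡ᵇ toℕ j

mark : ∀ {m n} → Subset (m * n) → Fin m → Fin n → ℕ
mark S i j = 𝟙 (lookup S (combine i j))

row : ∀ {m} n → Subset (m * n) → Fin m → ℕ
row n S i = ∑[ j < n ] mark S i j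

∣S∣≡∑𝟙 : ∀ {m} (S : Subset m) → ∣ S ∣ ≡ ∑[ i < m ] 𝟙 (lookup S i)
∣S∣≡∑𝟙 []          = refl
∣S∣≡∑𝟙 (true  ∷ S) = cong suc (∣S∣≡∑𝟙 S)
∣S∣≡∑𝟙 (false ∷ S) = ∣S∣≡∑𝟙 S

∣S∣≡∑row : ∀ {m} n (S : Subset (m * n)) → ∣ S ∣ ≡ ∑[ i < m ] row n S i
∣S∣≡∑row {m} n S = trans (∣S∣≡∑𝟙 S) (sum-combine m (𝟙 ∘ lookup S))

-- With degrees at most 4 no outside vertex has two outside neighbours,
-- so a 4-cycle a b — c b — c d — a d of G □ H meets S at least twice.
□-square : ∀ G H {S} → IsGOA (G □ H) S → (∀ i j → deg (G □ H) (combine i j) ≤ 4) →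
  ∀ {a c b d} → T (adj G a c) → T (adj G c a) → a ≢ c → T (adj H b d) → T (adj H d b) →
  2 ≤ (mark S a b + mark S c b) + (mark S a d + mark S c d)
□-square G H {S} goa deg≤4 {a} {c} {b} {d} ac ca a≢c bd db
  with lookup S (combine a b) in ab | lookup S (combine c b) in cb
     | lookup S (combine a d) in ad | lookup S (combine c d) in cd
... | true  | true  | _     | _     = s≤s (s≤s z≤n)
... | true  | false | true  | _     = s≤s (s≤s z≤n)
... | true  | false | false | true  = s≤s (s≤s z≤n)
... | false | true  | true  | _     = s≤s (s≤s z≤n)
... | false | true  | false | true  = s≤s (s≤s z≤n)
... | false | false | true  | true  = s≤s (s≤s z≤n)
... | true  | false | false | false = ⊥-elim $ goa-outside-cherry goa (deg≤4 c d) cd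
  (□-adj-col G H c db) cb (□-adj-row G H d ca) ad (combine-≢ˡ b d (a≢c ∘ sym))
... | false | true  | false | false = ⊥-elim $ goa-outside-cherry goa (deg≤4 a d) ad
  (□-adj-col G H a db) ab (□-adj-row G H d ac) cd (combine-≢ˡ b d a≢c)
... | false | false | true  | false = ⊥-elim $ goa-outside-cherry goa (deg≤4 c b) cb
  (□-adj-row G H b ca) ab (□-adj-col G H c bd) cd (combine-≢ˡ b d a≢c)
... | false | false | false | _     = ⊥-elim $ goa-outside-cherry goa (deg≤4 a b) ab
  (□-adj-row G H b ac) cb (□-adj-col G H a bd) ad (combine-≢ˡ b d (a≢c ∘ sym))

P-sym : ∀ {m} (i j : Fin m) → adj (P m) i j ≡ adj (P m) j i
P-sym i j = ∨-comm (suc (toℕ i) ≡ᵇ toℕ j) (suc (toℕ j) ≡ᵇ toℕ i)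

C-sym : ∀ {m} (i j : Fin m) → adj (C m) i j ≡ adj (C m) j i
C-sym {m} i j = swap (suc (toℕ i) ≡ᵇ toℕ j) (suc (toℕ j) ≡ᵇ toℕ i)
                     ((toℕ i ≡ᵇ 0) ∧ (suc (toℕ j) ≡ᵇ m)) ((toℕ j ≡ᵇ 0) ∧ (suc (toℕ i) ≡ᵇ m))
  where
  swap : ∀ w x y z → w ∨ x ∨ y ∨ z ≡ x ∨ w ∨ z ∨ y
  swap true  true  y z = refl
  swap true  false y z = refl
  swap false true  y z = refl
  swap false false y z = ∨-comm y z

path-edge-view : ∀ x y → T ((suc x ≡ᵇ y) ∨ (suc y ≡ᵇ x)) → suc x ≡ y ⊎ suc y ≡ x
path-edge-view zero          (suc zero)    _  = inj₁ refl
path-edge-view (suc zero)    zero          _  = inj₂ refl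
path-edge-view (suc x)       (suc y)       xy = Sum.map (cong suc) (cong suc) (path-edge-view x y xy)
path-edge-view zero          zero          ()
path-edge-view zero          (suc (suc y)) ()
path-edge-view (suc (suc x)) zero          ()

cycle-edge-view : ∀ t x y →
  T ((suc x ≡ᵇ y) ∨ (suc y ≡ᵇ x) ∨ ((x ≡ᵇ 0) ∧ (suc y ≡ᵇ t)) ∨ ((y ≡ᵇ 0) ∧ (suc x ≡ᵇ t))) →
  T ((suc x ≡ᵇ y) ∨ (suc y ≡ᵇ x)) ⊎ (x ≡ 0 ⊎ y ≡ 0)
cycle-edge-view t zero    y       _  = inj₂ (inj₁ refl)
cycle-edge-view t (suc x) zero    _  = inj₂ (inj₂ refl)
cycle-edge-view t (suc x) (suc y) xy = inj₁ (drop-wrap (suc x ≡ᵇ y) (suc y ≡ᵇ x) xy)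
  where
  drop-wrap : ∀ a b → T (a ∨ b ∨ false ∨ false) → T (a ∨ b)
  drop-wrap true  b     _ = _
  drop-wrap false true  _ = _

P-irrefl : ∀ {m} (i j : Fin m) → T (adj (P m) i j) → i ≢ j
P-irrefl i .i ii refl = [ 1+n≢n , 1+n≢n ] (path-edge-view (toℕ i) (toℕ i) ii)

P-adj-view : ∀ {m} (i j : Fin m) → T (adj (P m) i j) → suc (toℕ i) ≡ toℕ j ⊎ suc (toℕ j) ≡ toℕ i
P-adj-view i j = path-edge-view (toℕ i) (toℕ j)

C-adj-view : ∀ {m} (i j : Fin m) → T (adj (C m) i j) → T (adj (P m) i j) ⊎ (toℕ i ≡ 0 ⊎ toℕ j ≡ 0)
C-adj-view {m} i j = cycle-edge-view m (toℕ i) (toℕ j)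

P⊆C : ∀ {m} (i j : Fin m) → T (adj (P m) i j) → T (adj (C m) i j)
P⊆C i j = weaken (suc (toℕ i) ≡ᵇ toℕ j) (suc (toℕ j) ≡ᵇ toℕ i)
  where
  weaken : ∀ a b {c} → T (a ∨ b) → T (a ∨ b ∨ c)
  weaken true  b     _ = _
  weaken false true  _ = _

P-adj-inject₁ : ∀ {m} (i : Fin m) → T (adj (P (suc m)) (inject₁ i) (suc i))
P-adj-inject₁ zero    = _
P-adj-inject₁ (suc i) = P-adj-inject₁ i

C-adj-predᶜ : ∀ {m} (j : Fin (suc m)) → T (adj (C (suc m)) (predᶜ j) j)
C-adj-predᶜ {m} zero    =
  subst T (C-sym zero (fromℕ m)) (from (T-∨ {1 ≡ᵇ toℕ (fromℕ m)}) (inj₂ (from T-∨ (inj₁ last))))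
  where
  last : T (toℕ (fromℕ m) ≡ᵇ m)
  last = ≡⇒≡ᵇ _ _ (toℕ-fromℕ m)
C-adj-predᶜ     (suc j) = P⊆C (inject₁ j) (suc j) (P-adj-inject₁ j)

successors≤1 : ∀ t x → ∑[ j < t ] 𝟙 ((suc x ≡ᵇ toℕ j) ∨ ((toℕ j ≡ᵇ 0) ∧ (suc x ≡ᵇ t))) ≤ 1
successors≤1 t x with suc x ≟ t
... | yes refl = ∑𝟙≤1 {t} (λ j → (suc x ≡ᵇ toℕ j) ∨ ((toℕ j ≡ᵇ 0) ∧ (suc x ≡ᵇ suc x))) 0 λ j →
  [ (λ hit → contradiction (toℕ<n j) (<-irrefl (sym (≡ᵇ⇒≡ _ _ hit))))
  , (λ wrap → ≡ᵇ⇒≡ (toℕ j) 0 (proj₁ (to T-∧ wrap))) ] ∘ to (T-∨ {suc x ≡ᵇ toℕ j})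
... | no x+1≢t = ∑𝟙≤1 {t} (λ j → (suc x ≡ᵇ toℕ j) ∨ ((toℕ j ≡ᵇ 0) ∧ (suc x ≡ᵇ t))) (suc x) λ j →
  [ sym ∘ ≡ᵇ⇒≡ (suc x) (toℕ j)
  , (λ wrap → contradiction (≡ᵇ⇒≡ (suc x) t (proj₂ (to (T-∧ {toℕ j ≡ᵇ 0}) wrap))) x+1≢t) ] ∘ to (T-∨ {suc x ≡ᵇ toℕ j})

predecessors≤1 : ∀ t x → ∑[ j < t ] 𝟙 ((suc (toℕ j) ≡ᵇ x) ∨ ((x ≡ᵇ 0) ∧ (suc (toℕ j) ≡ᵇ t))) ≤ 1
predecessors≤1 t x with x ≟ 0
... | yes refl = ∑𝟙≤1 {t} (λ j → suc (toℕ j) ≡ᵇ t) (pred t) λ j → cong pred ∘ ≡ᵇ⇒≡ (suc (toℕ j)) t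
... | no x≢0   = ∑𝟙≤1 {t} (λ j → (suc (toℕ j) ≡ᵇ x) ∨ ((x ≡ᵇ 0) ∧ (suc (toℕ j) ≡ᵇ t))) (pred x) λ j →
  [ cong pred ∘ ≡ᵇ⇒≡ (suc (toℕ j)) x
  , (λ wrap → contradiction (≡ᵇ⇒≡ x 0 (proj₁ (to (T-∧ {x ≡ᵇ 0}) wrap))) x≢0) ] ∘ to (T-∨ {suc (toℕ j) ≡ᵇ x})

C-deg≤2 : ∀ t (b : Fin t) → deg (C t) b ≤ 2
C-deg≤2 t b = begin
  deg (C t) b                               ≤⟨ sum-mono-≤ {t} grouped ⟩
  ∑[ j < t ] (successor j + predecessor j)  ≡⟨ ∑-distrib-+ {t} successor predecessor ⟩
  sum successor + sum predecessor           ≤⟨ +-mono-≤ (successors≤1 t x) (predecessors≤1 t x) ⟩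
  2                                         ∎
  where
  open ≤-Reasoning
  x = toℕ b
  successor predecessor : Fin t → ℕ
  successor   j = 𝟙 ((suc x ≡ᵇ toℕ j) ∨ ((toℕ j ≡ᵇ 0) ∧ (suc x ≡ᵇ t)))
  predecessor j = 𝟙 ((suc (toℕ j) ≡ᵇ x) ∨ ((x ≡ᵇ 0) ∧ (suc (toℕ j) ≡ᵇ t)))
  grouped : ∀ j → 𝟙 (adj (C t) b j) ≤ successor j + predecessor j
  grouped j = 𝟙-∨₄≤ (suc x ≡ᵇ toℕ j) (suc (toℕ j) ≡ᵇ x)
                    ((x ≡ᵇ 0) ∧ (suc (toℕ j) ≡ᵇ t)) ((toℕ j ≡ᵇ 0) ∧ (suc x ≡ᵇ t))

P-deg≤2 : ∀ r (a : Fin r) → deg (P r) a ≤ 2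
P-deg≤2 r a = ≤-trans (sum-mono-≤ λ j → 𝟙-mono {adj (P r) a j} (P⊆C a j)) (C-deg≤2 r a)

⊤-isGOA : ∀ G → Fin (n G) → IsGOA G ⊤
⊤-isGOA G v = (v , ∈⊤) , λ u u∉⊤ → contradiction ∈⊤ u∉⊤

independent-complement⇒GOA : ∀ G {S} → Nonempty S →
  (∀ v u → lookup S v ≡ false → T (adj G v u) → lookup S u ≡ true) →
  (∀ v → lookup S v ≡ false → ∃[ u ] T (adj G v u) × lookup S u ≡ true) →
  IsGOA G S
independent-complement⇒GOA G {S} nonempty independent dominated = nonempty , attacked
  where
  attacked : ∀ v → v ∉ S → δ G (compl S) v + 1 ≤ δ G S v
  attacked v v∉S with dominated v (∉⇒lookup≡false v∉S)
  ... | u , vu , u∈S = subst (λ k → k + 1 ≤ δ G S v) (sym δ̄≡0) 1≤δ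
    where
    1≤δ : 1 ≤ δ G S v
    1≤δ = subst₂ _≤_ (𝟙-T (from T-∧ (vu , subst T (sym u∈S) _))) (sym (δ≡∑ G S v))
                     (f≤sum (λ x → 𝟙 (adj G v x ∧ lookup S x)) u)
    no-outside-neighbour : ∀ u → 𝟙 (adj G v u ∧ lookup (compl S) u) ≡ 0
    no-outside-neighbour u with adj G v u in vu
    ... | false = refl
    ... | true rewrite lookup-map u not S | independent v u (∉⇒lookup≡false v∉S) (subst T (sym vu) _) = refl
    δ̄≡0 : δ G (compl S) v ≡ 0
    δ̄≡0 = trans (δ≡∑ G (compl S) v) (trans (sum-cong-≗ no-outside-neighbour) (sum-replicate-zero (n G)))

alternating : Bool → (m : ℕ) → Subset m
alternating b zero    = []
alternating b (suc m) = b ∷ alternating (not b) m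

∣alternating-false∣ : ∀ m → ∣ alternating false m ∣ ≡ ⌊ m /2⌋
∣alternating-true∣  : ∀ m → ∣ alternating true  m ∣ ≡ ⌈ m /2⌉
∣alternating-false∣ zero    = refl
∣alternating-false∣ (suc m) = ∣alternating-true∣ m
∣alternating-true∣  zero    = refl
∣alternating-true∣  (suc m) = cong suc (∣alternating-false∣ m)

alternating-step : ∀ b {m} (i j : Fin m) → suc (toℕ i) ≡ toℕ j →
  lookup (alternating b m) j ≡ not (lookup (alternating b m) i)
alternating-step b zero    (suc zero) _  = refl
alternating-step b (suc i) (suc j)    ij = alternating-step (not b) i j (suc-injective ij)

≡not-sym : ∀ {x y} → x ≡ not y → y ≡ not x
≡not-sym {x} {y} x≡¬y = trans (sym (not-involutive y)) (cong not (sym x≡¬y))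

alternating-flip : ∀ b {m} (i j : Fin m) → T (adj (P m) i j) →
  lookup (alternating b m) j ≡ not (lookup (alternating b m) i)
alternating-flip b i j ij =
  [ alternating-step b i j , ≡not-sym ∘ alternating-step b j i ] (P-adj-view i j ij)

odd-vertices-isGOA : ∀ m → IsGOA (P (suc (suc m))) (alternating false (suc (suc m)))
odd-vertices-isGOA m = independent-complement⇒GOA (P (suc (suc m))) (suc zero , there here) independent dominated
  where
  S = alternating false (suc (suc m))
  independent : ∀ v u → lookup S v ≡ false → T (adj (P (suc (suc m))) v u) → lookup S u ≡ true
  independent v u v∉S vu = trans (alternating-flip false v u vu) (cong not v∉S)
  dominated : ∀ v → lookup S v ≡ false → ∃[ u ] T (adj (P (suc (suc m))) v u) × lookup S u ≡ true
  dominated zero    _     = suc zero , _ , refl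
  dominated (suc w) w+1∉S = inject₁ w , subst T (P-sym (inject₁ w) (suc w)) (P-adj-inject₁ w)
                          , trans (≡not-sym (alternating-flip false (inject₁ w) (suc w) (P-adj-inject₁ w))) (cong not w+1∉S)

even-vertices-isGOA : ∀ m → IsGOA (C (suc m)) (alternating true (suc m))
even-vertices-isGOA m = independent-complement⇒GOA (C (suc m)) (zero , here) independent dominated
  where
  S = alternating true (suc m)
  independent : ∀ v u → lookup S v ≡ false → T (adj (C (suc m)) v u) → lookup S u ≡ true
  independent (suc w) u v∉S vu with C-adj-view (suc w) u vu
  ... | inj₁ path-edge  = trans (alternating-flip true (suc w) u path-edge) (cong not v∉S)
  ... | inj₂ (inj₂ u≡0) rewrite toℕ-injective {j = zero} u≡0 = refl
  dominated : ∀ v → lookup S v ≡ false → ∃[ u ] T (adj (C (suc m)) v u) × lookup S u ≡ true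
  dominated (suc w) w+1∉S = inject₁ w , subst T (C-sym (inject₁ w) (suc w)) (C-adj-predᶜ (suc w))
                          , trans (≡not-sym (alternating-flip true (inject₁ w) (suc w) (P-adj-inject₁ w))) (cong not w+1∉S)

P□C-deg≤4 : ∀ r t i j → deg (P r □ C t) (combine i j) ≤ 4
P□C-deg≤4 r t i j = ≤-trans (□-deg≤ (P r) (C t) i j) (+-mono-≤ (P-deg≤2 r i) (C-deg≤2 t j))

double-≤ : ∀ {m n} → m + m ≤ n + n → m ≤ n
double-≤ {m} {n} m+m≤n+n = subst₂ _≤_ (sym (n≡⌊n+n/2⌋ m)) (sym (n≡⌊n+n/2⌋ n)) (⌊n/2⌋-mono m+m≤n+n)

ladder-bound : ∀ r t₁ {S} → IsGOA (P r □ C (suc t₁)) S →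
  ∀ i j → T (adj (P r) i j) → suc t₁ ≤ row (suc t₁) S i + row (suc t₁) S j
ladder-bound r t₁ {S} goa i j ij = double-≤ (begin
  t + t                         ≡⟨ trans (*-comm t 2) (cong (t +_) (+-identityʳ t)) ⟨
  t * 2                         ≤⟨ cycle-edge-bound 2 rung two-per-square ⟩
  sum rung + sum rung           ≡⟨ cong (λ k → k + k) (∑-distrib-+ (mark S i) (mark S j)) ⟩
  (row t S i + row t S j) + (row t S i + row t S j) ∎)
  where
  open ≤-Reasoning
  t = suc t₁
  rung : Fin t → ℕ
  rung k = mark S i k + mark S j k
  two-per-square : ∀ k → 2 ≤ rung (predᶜ k) + rung k
  two-per-square k = □-square (P r) (C t) goa (P□C-deg≤4 r t) {i} {j} {predᶜ k} {k}
    ij (subst T (P-sym i j) ij) (P-irrefl i j ij)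
    (C-adj-predᶜ k) (subst T (C-sym (predᶜ k) k) (C-adj-predᶜ k))

single-row-bound : ∀ t₁ {S} → IsGOA (P 1 □ C (suc t₁)) S → ⌈ suc t₁ /2⌉ ≤ ∣ S ∣
single-row-bound t₁ {S} goa = begin
  ⌈ t /2⌉           ≤⟨ ⌈n/2⌉-mono t≤r₀+r₀ ⟩
  ⌈ r₀ + r₀ /2⌉     ≡⟨ n≡⌈n+n/2⌉ r₀ ⟨
  r₀                ≡⟨ trans (∣S∣≡∑row {1} t S) (+-identityʳ r₀) ⟨
  ∣ S ∣             ∎
  where
  open ≤-Reasoning
  t = suc t₁
  r₀ = row {1} t S zero
  one-per-edge : ∀ k → 1 ≤ mark {1} S zero (predᶜ k) + mark {1} S zero k
  one-per-edge k = 𝟙-one-of (lookup S (combine {1} zero (predᶜ k))) (lookup S (combine {1} zero k))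
    λ k-1∉S k∉S → goa-outside-edge (P 1 □ C t) goa
                    (≤-trans (□-deg≤ (P 1) (C t) zero (predᶜ k)) (C-deg≤2 t (predᶜ k)))
                    k-1∉S (□-adj-col (P 1) (C t) zero {predᶜ k} {k} (C-adj-predᶜ k)) k∉S
  t≤r₀+r₀ : t ≤ r₀ + r₀
  t≤r₀+r₀ = subst (_≤ r₀ + r₀) (*-identityʳ t) (cycle-edge-bound 1 (mark {1} S zero) one-per-edge)

corollary25 : ∀ (r t : ℕ) → r ≥ 1 → t ≥ 3 →
    ∀ (a b c : ℕ) →
    IsGammaO (P r) a → IsGammaO (C t) b → IsGammaO (P r □ C t) c →
    a * b ≤ c
corollary25 (suc zero) (suc t₁) _ _ a b c (_ , a-min) (_ , b-min) ((S , S-goa , refl) , _) = begin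
  a * b                               ≤⟨ *-mono-≤ (a-min ⊤ (⊤-isGOA (P 1) zero)) (b-min _ (even-vertices-isGOA t₁)) ⟩
  1 * ∣ alternating true (suc t₁) ∣   ≡⟨ trans (*-identityˡ _) (∣alternating-true∣ (suc t₁)) ⟩
  ⌈ suc t₁ /2⌉                        ≤⟨ single-row-bound t₁ S-goa ⟩
  ∣ S ∣                               ∎
  where open ≤-Reasoning
corollary25 (suc (suc r₂)) (suc t₁) _ _ a b c (_ , a-min) (_ , b-min) ((S , S-goa , refl) , _) = begin
  a * b                               ≤⟨ *-mono-≤ (a-min _ (odd-vertices-isGOA r₂)) (b-min ⊤ (⊤-isGOA (C (suc t₁)) zero)) ⟩
  ∣ alternating false r ∣ * ∣ ⊤ {suc t₁} ∣ ≡⟨ cong₂ _*_ (∣alternating-false∣ r) (∣⊤∣≡n (suc t₁)) ⟩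
  ⌊ r /2⌋ * suc t₁                    ≤⟨ path-matching-bound {r} (suc t₁) (row (suc t₁) S) (ladder-bound r t₁ S-goa) ⟩
  sum (row {r} (suc t₁) S)            ≡⟨ ∣S∣≡∑row {r} (suc t₁) S ⟨
  ∣ S ∣                               ∎
  where
  open ≤-Reasoning
  r = suc (suc r₂)
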